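{- For every integer $\ell\geq 1$ and every factor $u$ of the Cantor sequence $\mathbf c$ that contains at least one letter $1$ and satisfies $3^{\ell}<|u|\leq 3^{\ell+1}$, we have $1\leq \mathrm{Card}(\mathrm{Type}(\ell+1, u))\leq 2$.
   Context: The Cantor sequence $\mathbf{c}=c_0c_1c_2\cdots\in\{0,1\}^{\mathbb N}$ is defined by $c_0=1$ and $c_{3n}=c_{3n+2}=c_n$, $c_{3n+1}=0$ for all $n\geq 0$. For a factor $u$ of $\mathbf c$ and $\ell\geq1$, $\mathrm{Type}(\ell,u)=\{j\in\{0,1,\dots,3^\ell-1\}\mid u=c_{3^\ell n+j}\cdots c_{3^\ell n+j+|u|-1}\text{ for some }n\geq0\}$. -}

module Defs where

open import Data.Nat using (ℕ; zero; suc; _+_; _*_; _^_; _<_)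
open import Data.Nat.DivMod using (_/_; _%_)
open import Data.Bool using (Bool; true; false)
open import Data.List using (List; []; _∷_; length)
open import Data.Product using (Σ; ∃; _×_; _,_)
open import Data.List.Relation.Unary.Any using (Any)
open import Relation.Binary.PropositionalEquality using (_≡_)

-- Auxiliary with fuel: implements c_0 = 1, c_{3n} = c_{3n+2} = c_n, c_{3n+1} = 0.
-- With fuel ≥ n+1 the fuel never runs out (n/3 < n for n ≥ 1).
cAux : ℕ → ℕ → Bool
cAux zero    _       = true
cAux (suc f) zero    = true
cAux (suc f) (suc m) with (suc m) % 3
... | 1 = false
... | _ = cAux f (suc m / 3)

-- The Cantor sequence c (letters 1 = true, 0 = false).
c : ℕ → Bool
c n = cAux (suc n) n

window : ℕ → ℕ → List Bool
window i zero    = []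
window i (suc k) = c i ∷ window (suc i) k

IsFactor : List Bool → Set
IsFactor u = ∃ λ i → window i (length u) ≡ u

Contains1 : List Bool → Set
Contains1 u = Any (_≡ true) u

InType : ℕ → List Bool → ℕ → Set
InType ℓ u j = (j < 3 ^ ℓ) × (∃ λ n → window (3 ^ ℓ * n + j) (length u) ≡ u)

-- Every factor has a type (the residue of any of its starting positions), so the content is
-- the bound "at most two".  It rests on a synchronisation property of c: two agreeing windows
-- of length 3^k + 1 containing a 1 start at positions congruent mod 3^k ('synchronise').  By
-- induction on k: the 1 fixes the phase mod 3 of both windows, which then desubstitute to
-- agreeing windows of length 3^(k-1) + 1 again containing a 1.  For occurrences of u starting
-- at P, a fixed 1 of u sits at P + w0; synchronisation with k = ℓ makes all P congruent mod
-- 3^ℓ, and the ℓ-th ternary digit of P + w0, which is 0 or 2 because c (P + w0) = 1, then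
-- determines P mod 3^(ℓ+1), i.e. the type.  Two possible digits leave at most two types.
module Submission where

open import Defs
open import Data.Nat
open import Data.Nat.Properties
open import Data.Nat.DivMod hiding (_mod_)
open import Data.Nat.Divisibility using (n∣m*n)
open import Data.Bool using (Bool; true; false; _∧_)
open import Data.Bool.Properties using (∧-assoc)
open import Data.List using (List; _∷_; length)
open import Data.List.Relation.Unary.Any using (here; there)
import Data.List.Properties as List
open import Data.Product using (∃; ∃-syntax; _×_; _,_)
open import Data.Sum using (_⊎_; inj₁; inj₂) renaming (map to map-⊎)
open import Data.Empty using (⊥; ⊥-elim)
open import Relation.Nullary using (yes; no)
open import Relation.Binary.PropositionalEquality
open import Data.Nat.Tactic.RingSolver using (solve-∀)

cAux-unfold : ∀ f m → cAux (suc f) (suc m) ≡ c (suc m % 3) ∧ cAux f (suc m / 3)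
cAux-unfold f m with suc m % 3 | m%n<n (suc m) 3
... | 0 | _ = refl
... | 1 | _ = refl
... | 2 | _ = refl
... | suc (suc (suc _)) | s≤s (s≤s (s≤s ()))

cAux-fuel : ∀ f g n → n < f → n < g → cAux f n ≡ cAux g n
cAux-fuel (suc f) (suc g) zero _ _ = refl
cAux-fuel (suc f) (suc g) (suc m) (s≤s m<f) (s≤s m<g) = begin
  cAux (suc f) (suc m)                ≡⟨ cAux-unfold f m ⟩
  c (suc m % 3) ∧ cAux f (suc m / 3)  ≡⟨ cong (c (suc m % 3) ∧_)
                                          (cAux-fuel f g (suc m / 3) (≤-<-trans q≤m m<f) (≤-<-trans q≤m m<g)) ⟩
  c (suc m % 3) ∧ cAux g (suc m / 3)  ≡⟨ sym (cAux-unfold g m) ⟩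
  cAux (suc g) (suc m)                ∎
  where
  open ≡-Reasoning
  q≤m : suc m / 3 ≤ m
  q≤m = <⇒≤pred (m/n<m (suc m) 3 (s≤s (s≤s z≤n)))

c-unfold : ∀ x → c x ≡ c (x % 3) ∧ c (x / 3)
c-unfold zero    = refl
c-unfold (suc m) = trans (cAux-unfold (suc m) m) (cong (c (suc m % 3) ∧_)
  (cAux-fuel (suc m) (suc (suc m / 3)) (suc m / 3) (m/n<m (suc m) 3 (s≤s (s≤s z≤n))) ≤-refl))

c-digit : ∀ d q → d < 3 → c (d + q * 3) ≡ c d ∧ c q
c-digit d q d<3 = trans (c-unfold (d + q * 3)) (cong₂ (λ r s → c r ∧ c s) last rest)
  where
  last : (d + q * 3) % 3 ≡ d
  last = trans ([m+kn]%n≡m%n d q 3) (m<n⇒m%n≡m d<3)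
  rest : (d + q * 3) / 3 ≡ q
  rest = begin
    (d + q * 3) / 3      ≡⟨ +-distrib-/-∣ʳ d (n∣m*n q) ⟩
    d / 3 + q * 3 / 3    ≡⟨ cong₂ _+_ (m<n⇒m/n≡0 d<3) (m*n/n≡m q 3) ⟩
    q                    ∎
    where open ≡-Reasoning

-- Self-similarity of c: for h < 3^k, the letter at h + q·3^k is c h ∧ c q
-- (a position carries a 1 iff none of its ternary digits is 1).
c-block : ∀ k h q → h < 3 ^ k → c (h + q * 3 ^ k) ≡ c h ∧ c q
c-block zero    zero    q _        = cong c (*-identityʳ q)
c-block zero    (suc h) q (s≤s ())
c-block (suc k) h       q h<3^k+1  = begin
  c (h + q * 3 ^ suc k)                ≡⟨ cong c regroup ⟩
  c (h % 3 + (h / 3 + q * 3 ^ k) * 3)  ≡⟨ c-digit (h % 3) (h / 3 + q * 3 ^ k) (m%n<n h 3) ⟩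
  c (h % 3) ∧ c (h / 3 + q * 3 ^ k)    ≡⟨ cong (c (h % 3) ∧_) (c-block k (h / 3) q h/3<3^k) ⟩
  c (h % 3) ∧ (c (h / 3) ∧ c q)        ≡⟨ sym (∧-assoc (c (h % 3)) (c (h / 3)) (c q)) ⟩
  (c (h % 3) ∧ c (h / 3)) ∧ c q        ≡⟨ cong (_∧ c q) (sym (c-unfold h)) ⟩
  c h ∧ c q                            ∎
  where
  open ≡-Reasoning
  h/3<3^k : h / 3 < 3 ^ k
  h/3<3^k = m<n*o⇒m/o<n (subst (h <_) (*-comm 3 (3 ^ k)) h<3^k+1)
  shuffle : ∀ r a q N → r + a * 3 + q * (3 * N) ≡ r + (a + q * N) * 3
  shuffle = solve-∀
  regroup : h + q * 3 ^ suc k ≡ h % 3 + (h / 3 + q * 3 ^ k) * 3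
  regroup = trans (cong (_+ q * 3 ^ suc k) (m≡m%n+[m/n]*n h 3)) (shuffle (h % 3) (h / 3) q (3 ^ k))

one-phase : ∀ q → c q ≡ true → q % 3 ≡ 0 ⊎ q % 3 ≡ 2
one-phase q one with q % 3 | m%n<n q 3 | trans (sym (c-unfold q)) one
... | 0 | _ | _ = inj₁ refl
... | 1 | _ | ()
... | 2 | _ | _ = inj₂ refl
... | suc (suc (suc _)) | s≤s (s≤s (s≤s ())) | _

c-even-digit : ∀ {e} → e ≡ 0 ⊎ e ≡ 2 → ∀ q → c (e + q * 3) ≡ c q
c-even-digit (inj₁ refl) q = c-digit 0 q (s≤s z≤n)
c-even-digit (inj₂ refl) q = c-digit 2 q (s≤s (s≤s (s≤s z≤n)))

∧-true-right : ∀ a b → a ∧ b ≡ true → b ≡ true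
∧-true-right true _ b≡true = b≡true

module _ (k : ℕ) where
  private instance
    3^k≢0 : NonZero (3 ^ k)
    3^k≢0 = m^n≢0 3 k

  c-split : ∀ x → c x ≡ c (x % 3 ^ k) ∧ c (x / 3 ^ k)
  c-split x = trans (cong c (m≡m%n+[m/n]*n x (3 ^ k)))
    (c-block k (x % 3 ^ k) (x / 3 ^ k) (m%n<n x (3 ^ k)))

  one-above : ∀ x → c x ≡ true → c (x / 3 ^ k) ≡ true
  one-above x one = ∧-true-right _ _ (trans (sym (c-split x)) one)

  digit : ℕ → ℕ
  digit x = x / 3 ^ k % 3

  digit-of-one : ∀ x → c x ≡ true → digit x ≡ 0 ⊎ digit x ≡ 2
  digit-of-one x one = one-phase (x / 3 ^ k) (one-above x one)

-- Congruence modulo m, in the subtraction-free form x + q·m = y + q'·m.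
infix 4 _≡_mod_
_≡_mod_ : ℕ → ℕ → ℕ → Set
x ≡ y mod m = ∃[ q ] ∃[ q' ] (x + q * m ≡ y + q' * m)

≡mod-1 : ∀ x y → x ≡ y mod 1
≡mod-1 x y = y , x , swap x y
  where
  swap : ∀ x y → x + y * 1 ≡ y + x * 1
  swap = solve-∀

≡mod-+ʳ : ∀ {x y m} t → x ≡ y mod m → x + t ≡ y + t mod m
≡mod-+ʳ {x} {y} {m} t (q , q' , eq) = q , q' , (begin
  x + t + q * m  ≡⟨ shuffle x t (q * m) ⟩
  x + q * m + t  ≡⟨ cong (_+ t) eq ⟩
  y + q' * m + t ≡⟨ shuffle y (q' * m) t ⟩
  y + t + q' * m ∎)
  where
  open ≡-Reasoning
  shuffle : ∀ a b c → a + b + c ≡ a + c + b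
  shuffle = solve-∀

≡mod-cancelʳ : ∀ {x y m} t → x + t ≡ y + t mod m → x ≡ y mod m
≡mod-cancelʳ {x} {y} {m} t (q , q' , eq) = q , q' , +-cancelʳ-≡ t _ _ (begin
  x + q * m + t  ≡⟨ shuffle x (q * m) t ⟩
  x + t + q * m  ≡⟨ eq ⟩
  y + t + q' * m ≡⟨ shuffle y t (q' * m) ⟩
  y + q' * m + t ∎)
  where
  open ≡-Reasoning
  shuffle : ∀ a b c → a + b + c ≡ a + c + b
  shuffle = solve-∀

%≡⇒≡mod : ∀ {x y m} .{{_ : NonZero m}} → x % m ≡ y % m → x ≡ y mod m
%≡⇒≡mod {x} {y} {m} eq = y / m , x / m , (begin
  x + y / m * m                  ≡⟨ cong (_+ y / m * m) (m≡m%n+[m/n]*n x m) ⟩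
  x % m + x / m * m + y / m * m  ≡⟨ cong (λ r → r + x / m * m + y / m * m) eq ⟩
  y % m + x / m * m + y / m * m  ≡⟨ shuffle (y % m) (x / m * m) (y / m * m) ⟩
  y % m + y / m * m + x / m * m  ≡⟨ cong (_+ x / m * m) (sym (m≡m%n+[m/n]*n y m)) ⟩
  y + x / m * m                  ∎)
  where
  open ≡-Reasoning
  shuffle : ∀ a b c → a + b + c ≡ a + c + b
  shuffle = solve-∀

≡mod⇒%≡ : ∀ {x y m} .{{_ : NonZero m}} → x ≡ y mod m → x % m ≡ y % m
≡mod⇒%≡ {x} {y} {m} (q , q' , eq) =
  trans (sym ([m+kn]%n≡m%n x q m)) (trans (cong (_% m) eq) ([m+kn]%n≡m%n y q' m))

≡mod-combine : ∀ {x y n m} .{{_ : NonZero n}} → x % n ≡ y % n → x / n ≡ y / n mod m →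
  x ≡ y mod n * m
≡mod-combine {x} {y} {n} {m} rem (q , q' , quot) = q , q' , (begin
  x + q * (n * m)              ≡⟨ split x q ⟩
  x % n + (x / n + q * m) * n  ≡⟨ cong₂ (λ r s → r + s * n) rem quot ⟩
  y % n + (y / n + q' * m) * n ≡⟨ sym (split y q') ⟩
  y + q' * (n * m)             ∎)
  where
  open ≡-Reasoning
  shuffle : ∀ r a q n m → r + a * n + q * (n * m) ≡ r + (a + q * m) * n
  shuffle = solve-∀
  split : ∀ z p → z + p * (n * m) ≡ z % n + (z / n + p * m) * n
  split z p = trans (cong (_+ p * (n * m)) (m≡m%n+[m/n]*n z n)) (shuffle (z % n) (z / n) p n m)

record Agree (L i i' : ℕ) : Set where
  constructor agreement
  field letter : ∀ t → t < L → c (i + t) ≡ c (i' + t)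
open Agree

agree-sym : ∀ {L i i'} → Agree L i i' → Agree L i' i
agree-sym agree = agreement λ t t<L → sym (letter agree t t<L)

true≢false : true ≢ false
true≢false ()

front : ∀ i y → 2 + (i + y) ≡ i + (2 + y)
front i y = sym (trans (+-suc i (suc y)) (cong suc (+-suc i y)))

-- Two places to the right of a 1 at position 3b there is again a 1, whereas two places to
-- the right of a position 3b'+2 there is a 0; so such positions cannot face each other.
clash-right : ∀ {N i i' x0 b b'} → Agree (suc (3 * N)) i i' → x0 + 2 ≤ 3 * N →
  i + x0 ≡ b * 3 → i' + x0 ≡ 2 + b' * 3 → c b ≡ true → ⊥
clash-right {i = i} {i'} {x0} {b} {b'} agree fits e e' one = true≢false (begin
  true                   ≡⟨ sym one ⟩
  c b                    ≡⟨ sym (c-digit 2 b (s≤s (s≤s (s≤s z≤n)))) ⟩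
  c (2 + b * 3)          ≡⟨ cong c (sym right) ⟩
  c (i + (x0 + 2))       ≡⟨ letter agree (x0 + 2) (s≤s fits) ⟩
  c (i' + (x0 + 2))      ≡⟨ cong c right' ⟩
  c (1 + suc b' * 3)     ≡⟨ c-digit 1 (suc b') (s≤s (s≤s z≤n)) ⟩
  false                  ∎)
  where
  open ≡-Reasoning
  right : i + (x0 + 2) ≡ 2 + b * 3
  right = trans (sym (+-assoc i x0 2)) (trans (cong (_+ 2) e) (+-comm (b * 3) 2))
  right' : i' + (x0 + 2) ≡ 1 + suc b' * 3
  right' = trans (sym (+-assoc i' x0 2)) (trans (cong (_+ 2) e') (shift b'))
    where
    shift : ∀ x → 2 + x * 3 + 2 ≡ 1 + (1 + x) * 3
    shift = solve-∀

-- Mirror image near the right end of the window: two places to the left of a 1 at 3b'+2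
-- there is a 1 (at 3b'), whereas two places to the left of 3b there is a 0.
clash-left : ∀ {N i i' y b b'} → Agree (suc (3 * N)) i i' → 2 + y ≤ 3 * N →
  i + (2 + y) ≡ b * 3 → i' + (2 + y) ≡ 2 + b' * 3 → c b ≡ true → ⊥
clash-left {i = i} {y = y} {b = zero} _ _ e _ _ with trans (front i y) e
... | ()   -- the position i + (2 + y) is not 0
clash-left {i = i} {i'} {y} {suc b} {b'} agree fits e e' one = true≢false (begin
  true                  ≡⟨ sym one ⟩
  c (suc b)             ≡⟨ sym (c-digit 0 (suc b) (s≤s z≤n)) ⟩
  c (suc b * 3)         ≡⟨ cong c (sym e) ⟩
  c (i + (2 + y))       ≡⟨ letter agree (2 + y) (s≤s fits) ⟩
  c (i' + (2 + y))      ≡⟨ cong c e' ⟩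
  c (2 + b' * 3)        ≡⟨ c-digit 2 b' (s≤s (s≤s (s≤s z≤n))) ⟩
  c b'                  ≡⟨ sym (c-digit 0 b' (s≤s z≤n)) ⟩
  c (b' * 3)            ≡⟨ cong c (sym left') ⟩
  c (i' + y)            ≡⟨ sym (letter agree y (s≤s (≤-trans (m≤n+m y 2) fits))) ⟩
  c (i + y)             ≡⟨ cong c left ⟩
  c (1 + b * 3)         ≡⟨ c-digit 1 b (s≤s (s≤s z≤n)) ⟩
  false                 ∎)
  where
  open ≡-Reasoning
  left : i + y ≡ 1 + b * 3
  left = +-cancelˡ-≡ 2 _ _ (trans (front i y) e)
  left' : i' + y ≡ b' * 3
  left' = +-cancelˡ-≡ 2 _ _ (trans (front i' y) e')

-- A 1 at position 3b and a 1 at position 3b'+2 cannot sit at the same offset x0 ≤ 3N of two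
-- agreeing windows of length 3N + 1 (N ≥ 1): look two places right, or left if x0 ≥ 2.
phase-clash : ∀ {N i i' x0 b b'} → 1 ≤ N → Agree (suc (3 * N)) i i' → x0 ≤ 3 * N →
  i + x0 ≡ b * 3 → i' + x0 ≡ 2 + b' * 3 → c b ≡ true → ⊥
phase-clash {N} {x0 = zero}        {b} {b'} N≥1 agree _ =
  clash-right {N} {b = b} {b'} agree (≤-trans (n≤1+n 2) (*-monoʳ-≤ 3 N≥1))
phase-clash {N} {x0 = suc zero}    {b} {b'} N≥1 agree _ =
  clash-right {N} {b = b} {b'} agree (*-monoʳ-≤ 3 N≥1)
phase-clash {N} {x0 = suc (suc y)} {b} {b'} _   agree x0≤ =
  clash-left {N} {b = b} {b'} agree x0≤

same-phase : ∀ {N i i' x0} → 1 ≤ N → Agree (suc (3 * N)) i i' → x0 ≤ 3 * N →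
  c (i + x0) ≡ true → i % 3 ≡ i' % 3
same-phase {i = i} {i'} {x0} N≥1 agree x0≤ one =
  ≡mod⇒%≡ {i} {i'} (≡mod-cancelʳ x0 (%≡⇒≡mod {i + x0} {i' + x0}
    (aligned (one-phase (i + x0) one) (one-phase (i' + x0) one'))))
  where
  one' : c (i' + x0) ≡ true
  one' = trans (sym (letter agree x0 (s≤s x0≤))) one
  phase0 : ∀ p → p % 3 ≡ 0 → p ≡ p / 3 * 3
  phase0 p p%3≡0 = trans (m≡m%n+[m/n]*n p 3) (cong (_+ p / 3 * 3) p%3≡0)
  phase2 : ∀ p → p % 3 ≡ 2 → p ≡ 2 + p / 3 * 3
  phase2 p p%3≡2 = trans (m≡m%n+[m/n]*n p 3) (cong (_+ p / 3 * 3) p%3≡2)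
  aligned : (i + x0) % 3 ≡ 0 ⊎ (i + x0) % 3 ≡ 2 → (i' + x0) % 3 ≡ 0 ⊎ (i' + x0) % 3 ≡ 2 →
    (i + x0) % 3 ≡ (i' + x0) % 3
  aligned (inj₁ p) (inj₁ p') = trans p (sym p')
  aligned (inj₂ p) (inj₂ p') = trans p (sym p')
  aligned (inj₁ p) (inj₂ p') = ⊥-elim (phase-clash {b = (i + x0) / 3} {b' = (i' + x0) / 3}
    N≥1 agree x0≤ (phase0 (i + x0) p) (phase2 (i' + x0) p') (one-above 1 (i + x0) one))
  aligned (inj₂ p) (inj₁ p') = ⊥-elim (phase-clash {b = (i' + x0) / 3} {b' = (i + x0) / 3}
    N≥1 (agree-sym agree) x0≤ (phase0 (i' + x0) p') (phase2 (i + x0) p) (one-above 1 (i' + x0) one'))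

-- Every block index s ≤ N (N ≥ 1) is reached from a digit d at some offset t ≤ 3N landing on a
-- letter-preserving position e + 3s of the block (e ∈ {0, 2}).
block-offset : ∀ {N d} s → 1 ≤ N → d < 3 → s ≤ N →
  ∃[ t ] ∃[ e ] (t ≤ 3 * N × (e ≡ 0 ⊎ e ≡ 2) × d + t ≡ e + s * 3)
block-offset {N} {d} zero N≥1 d<3 _ =
  2 ∸ d , 2 , ≤-trans (m∸n≤m 2 d) (≤-trans (n≤1+n 2) (*-monoʳ-≤ 3 N≥1)) , inj₂ refl ,
  m+[n∸m]≡n (<⇒≤pred d<3)
block-offset {N} {d} (suc s) _ d<3 s<N =
  suc s * 3 ∸ d , 0 ,
  ≤-trans (m∸n≤m (suc s * 3) d) (subst (suc s * 3 ≤_) (*-comm N 3) (*-monoˡ-≤ 3 s<N)) ,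
  inj₁ refl , m+[n∸m]≡n (≤-trans (<⇒≤ d<3) (m≤m+n 3 (s * 3)))

desubstitute : ∀ {N i i'} → 1 ≤ N → i % 3 ≡ i' % 3 → Agree (suc (3 * N)) i i' →
  Agree (suc N) (i / 3) (i' / 3)
desubstitute {N} {i} {i'} N≥1 phase agree = agreement letter-above
  where
  letter-above : ∀ s → s < suc N → c (i / 3 + s) ≡ c (i' / 3 + s)
  letter-above s (s≤s s≤N) with block-offset s N≥1 (m%n<n i 3) s≤N
  ... | t , e , t≤3N , even , offset = begin
    c (i / 3 + s)             ≡⟨ sym (c-even-digit even (i / 3 + s)) ⟩
    c (e + (i / 3 + s) * 3)   ≡⟨ cong c (sym (regroup i offset)) ⟩
    c (i + t)                 ≡⟨ letter agree t (s≤s t≤3N) ⟩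
    c (i' + t)                ≡⟨ cong c (regroup i' (trans (cong (_+ t) (sym phase)) offset)) ⟩
    c (e + (i' / 3 + s) * 3)  ≡⟨ c-even-digit even (i' / 3 + s) ⟩
    c (i' / 3 + s)            ∎
    where
    open ≡-Reasoning
    shuffle : ∀ r a t → r + a * 3 + t ≡ r + t + a * 3
    shuffle = solve-∀
    collect : ∀ e s a → e + s * 3 + a * 3 ≡ e + (a + s) * 3
    collect = solve-∀
    regroup : ∀ j → j % 3 + t ≡ e + s * 3 → j + t ≡ e + (j / 3 + s) * 3
    regroup j off = begin
      j + t                  ≡⟨ cong (_+ t) (m≡m%n+[m/n]*n j 3) ⟩
      j % 3 + j / 3 * 3 + t  ≡⟨ shuffle (j % 3) (j / 3) t ⟩
      j % 3 + t + j / 3 * 3  ≡⟨ cong (_+ j / 3 * 3) off ⟩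
      e + s * 3 + j / 3 * 3  ≡⟨ collect e s (j / 3) ⟩
      e + (j / 3 + s) * 3    ∎

ascend-one : ∀ {N i x0} → x0 ≤ 3 * N → c (i + x0) ≡ true → ∃[ s ] (s ≤ N × c (i / 3 + s) ≡ true)
ascend-one {N} {i} {x0} x0≤3N one =
  (i % 3 + x0) / 3 , s≤N , subst (λ p → c p ≡ true) quotient (one-above 1 (i + x0) one)
  where
  open ≡-Reasoning
  shuffle : ∀ r a x → r + a * 3 + x ≡ r + x + a * 3
  shuffle = solve-∀
  quotient : (i + x0) / 3 ≡ i / 3 + (i % 3 + x0) / 3
  quotient = begin
    (i + x0) / 3                      ≡⟨ cong (_/ 3) (cong (_+ x0) (m≡m%n+[m/n]*n i 3)) ⟩
    (i % 3 + i / 3 * 3 + x0) / 3      ≡⟨ cong (_/ 3) (shuffle (i % 3) (i / 3) x0) ⟩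
    (i % 3 + x0 + i / 3 * 3) / 3      ≡⟨ +-distrib-/-∣ʳ (i % 3 + x0) (n∣m*n (i / 3)) ⟩
    (i % 3 + x0) / 3 + i / 3 * 3 / 3  ≡⟨ cong ((i % 3 + x0) / 3 +_) (m*n/n≡m (i / 3) 3) ⟩
    (i % 3 + x0) / 3 + i / 3          ≡⟨ +-comm ((i % 3 + x0) / 3) (i / 3) ⟩
    i / 3 + (i % 3 + x0) / 3          ∎
  s≤N : (i % 3 + x0) / 3 ≤ N
  s≤N = <⇒≤pred (m<n*o⇒m/o<n (+-mono-<-≤ (m%n<n i 3) (subst (x0 ≤_) (*-comm 3 N) x0≤3N)))

-- Synchronisation: two agreeing windows of length 3^k + 1 containing a 1 start at positions
-- congruent mod 3^k.  Induction on k: same phase mod 3, then desubstitute.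
synchronise : ∀ k {i i'} → Agree (suc (3 ^ k)) i i' → ∃[ x0 ] (x0 ≤ 3 ^ k × c (i + x0) ≡ true) →
  i ≡ i' mod 3 ^ k
synchronise zero    {i} {i'} _ _ = ≡mod-1 i i'
synchronise (suc k) {i} {i'} agree (x0 , x0≤ , one) =
  ≡mod-combine phase (synchronise k (desubstitute 3^k≥1 phase agree) (ascend-one {i = i} x0≤ one))
  where
  3^k≥1 : 1 ≤ 3 ^ k
  3^k≥1 = m^n>0 3 k
  phase : i % 3 ≡ i' % 3
  phase = same-phase 3^k≥1 agree x0≤ one

sub-window : ∀ {m L w0} → m < L → w0 < L → ∃[ σ ] ∃[ x0 ] (σ + x0 ≡ w0 × x0 ≤ m × σ + m < L)
sub-window {m} {L} {w0} m<L w0<L with m ≤? w0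
... | yes m≤w0 = w0 ∸ m , m , m∸n+n≡m m≤w0 , ≤-refl , subst (_< L) (sym (m∸n+n≡m m≤w0)) w0<L
... | no  m≰w0 = 0 , w0 , refl , <⇒≤ (≰⇒> m≰w0) , m<L

agree-shift : ∀ {L i i'} σ {m} → σ + m < L → Agree L i i' → Agree (suc m) (i + σ) (i' + σ)
agree-shift {i = i} {i'} σ fits agree = agreement λ t t<1+m → begin
  c (i + σ + t)    ≡⟨ cong c (+-assoc i σ t) ⟩
  c (i + (σ + t))  ≡⟨ letter agree (σ + t) (≤-<-trans (+-monoʳ-≤ σ (<⇒≤pred t<1+m)) fits) ⟩
  c (i' + (σ + t)) ≡⟨ cong c (sym (+-assoc i' σ t)) ⟩
  c (i' + σ + t)   ∎
  where open ≡-Reasoning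

-- Two agreeing windows of any length L > 3^k containing a 1 start at positions congruent
-- mod 3^k: synchronise on a sub-window of length 3^k + 1 around the 1.
agree⇒≡mod : ∀ k {L i i' w0} → 3 ^ k < L → Agree L i i' → w0 < L → c (i + w0) ≡ true →
  i ≡ i' mod 3 ^ k
agree⇒≡mod k {i = i} 3^k<L agree w0<L one with sub-window 3^k<L w0<L
... | σ , x0 , refl , x0≤ , fits = ≡mod-cancelʳ σ
  (synchronise k (agree-shift σ fits agree) (x0 , x0≤ , trans (cong c (+-assoc i σ x0)) one))

window-agree : ∀ {L} i i' → window i L ≡ window i' L → Agree L i i'
window-agree {L} i i' eq = agreement (letters L i i' eq)
  where
  letters : ∀ L i i' → window i L ≡ window i' L → ∀ t → t < L → c (i + t) ≡ c (i' + t)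
  letters (suc L) i i' eq zero _ =
    trans (cong c (+-identityʳ i)) (trans (List.∷-injectiveˡ eq) (cong c (sym (+-identityʳ i'))))
  letters (suc L) i i' eq (suc t) (s≤s t<L) =
    trans (cong c (+-suc i t))
      (trans (letters L (suc i) (suc i') (List.∷-injectiveʳ eq) t t<L) (cong c (sym (+-suc i' t))))

one-offset : ∀ u → Contains1 u →
  ∃[ w0 ] (w0 < length u × (∀ P → window P (length u) ≡ u → c (P + w0) ≡ true))
one-offset (x ∷ u) (here x≡true) = 0 , s≤s z≤n , λ P occ →
  trans (cong c (+-identityʳ P)) (trans (List.∷-injectiveˡ occ) x≡true)
one-offset (x ∷ u) (there has1) with one-offset u has1
... | w0 , w0<|u| , one-at = suc w0 , s≤s w0<|u| , λ P occ →
  trans (cong c (+-suc P w0)) (one-at (suc P) (List.∷-injectiveʳ occ))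

module _ (ℓ : ℕ) where
  private instance
    3^ℓ≢0 : NonZero (3 ^ ℓ)
    3^ℓ≢0 = m^n≢0 3 ℓ

  start : ∀ {u j} → InType ℓ u j → ℕ
  start {j = j} (_ , n , _) = 3 ^ ℓ * n + j

  start-residue : ∀ {u j} (o : InType ℓ u j) → start o % 3 ^ ℓ ≡ j
  start-residue {j = j} (j<3^ℓ , n , _) = begin
    (3 ^ ℓ * n + j) % 3 ^ ℓ  ≡⟨ cong (_% 3 ^ ℓ) (trans (+-comm (3 ^ ℓ * n) j) (cong (j +_) (*-comm _ n))) ⟩
    (j + n * 3 ^ ℓ) % 3 ^ ℓ  ≡⟨ [m+kn]%n≡m%n j n (3 ^ ℓ) ⟩
    j % 3 ^ ℓ                ≡⟨ m<n⇒m%n≡m j<3^ℓ ⟩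
    j                        ∎
    where open ≡-Reasoning

  has-type : ∀ {u} → IsFactor u → ∃ λ j → InType ℓ u j
  has-type {u} (i , occ) =
    i % 3 ^ ℓ , m%n<n i (3 ^ ℓ) , i / 3 ^ ℓ , subst (λ p → window p (length u) ≡ u) i≡ occ
    where
    i≡ : i ≡ 3 ^ ℓ * (i / 3 ^ ℓ) + i % 3 ^ ℓ
    i≡ = trans (m≡m%n+[m/n]*n i (3 ^ ℓ))
      (trans (+-comm (i % 3 ^ ℓ) (i / 3 ^ ℓ * 3 ^ ℓ)) (cong (_+ i % 3 ^ ℓ) (*-comm (i / 3 ^ ℓ) (3 ^ ℓ))))

-- Two occurrences of u (|u| > 3^ℓ) at level ℓ + 1 whose 1 at offset w0 has the same ℓ-th
-- ternary digit have the same type: their starts agree mod 3^ℓ by synchronisation, and the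
-- common digit lifts this to agreement mod 3^(ℓ+1).
same-digit⇒same-type : ∀ ℓ {u j j' w0} → 3 ^ ℓ < length u → w0 < length u →
  (o : InType (suc ℓ) u j) (o' : InType (suc ℓ) u j') → c (start (suc ℓ) o + w0) ≡ true →
  digit ℓ (start (suc ℓ) o + w0) ≡ digit ℓ (start (suc ℓ) o' + w0) → j ≡ j'
same-digit⇒same-type ℓ {u} {j} {j'} {w0} |u|>3^ℓ w0<|u| o@(_ , _ , occ) o'@(_ , _ , occ')
  one same-digit = begin
    j               ≡⟨ sym (start-residue (suc ℓ) o) ⟩
    P % 3 ^ suc ℓ   ≡⟨ ≡mod⇒%≡ (≡mod-cancelʳ w0 (subst (P + w0 ≡ P' + w0 mod_) (*-comm (3 ^ ℓ) 3) lifted)) ⟩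
    P' % 3 ^ suc ℓ  ≡⟨ start-residue (suc ℓ) o' ⟩
    j'              ∎
  where
  open ≡-Reasoning
  instance
    3^ℓ≢0 : NonZero (3 ^ ℓ)
    3^ℓ≢0 = m^n≢0 3 ℓ
    3^ℓ+1≢0 : NonZero (3 ^ suc ℓ)
    3^ℓ+1≢0 = m^n≢0 3 (suc ℓ)
  P P' : ℕ
  P  = start (suc ℓ) o
  P' = start (suc ℓ) o'
  starts : P ≡ P' mod 3 ^ ℓ
  starts = agree⇒≡mod ℓ |u|>3^ℓ (window-agree P P' (trans occ (sym occ'))) w0<|u| one
  lifted : P + w0 ≡ P' + w0 mod 3 ^ ℓ * 3
  lifted = ≡mod-combine (≡mod⇒%≡ (≡mod-+ʳ w0 starts)) (%≡⇒≡mod same-digit)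

two-of-three : ∀ {y₁ y₂ y₃ : ℕ} → y₁ ≡ 0 ⊎ y₁ ≡ 2 → y₂ ≡ 0 ⊎ y₂ ≡ 2 → y₃ ≡ 0 ⊎ y₃ ≡ 2 →
  y₁ ≡ y₂ ⊎ y₁ ≡ y₃ ⊎ y₂ ≡ y₃
two-of-three (inj₁ refl) (inj₁ refl) _           = inj₁ refl
two-of-three (inj₂ refl) (inj₂ refl) _           = inj₁ refl
two-of-three (inj₁ refl) (inj₂ refl) (inj₁ refl) = inj₂ (inj₁ refl)
two-of-three (inj₁ refl) (inj₂ refl) (inj₂ refl) = inj₂ (inj₂ refl)
two-of-three (inj₂ refl) (inj₁ refl) (inj₁ refl) = inj₂ (inj₂ refl)
two-of-three (inj₂ refl) (inj₁ refl) (inj₂ refl) = inj₂ (inj₁ refl)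

-- A factor of length > 3^ℓ containing a 1 has at most two types at level ℓ + 1: the type of an
-- occurrence is determined by the ℓ-th digit of the position of the 1, which is 0 or 2.
at-most-two-types : ∀ ℓ {u} → Contains1 u → 3 ^ ℓ < length u → (j₁ j₂ j₃ : ℕ) →
  InType (suc ℓ) u j₁ → InType (suc ℓ) u j₂ → InType (suc ℓ) u j₃ →
  (j₁ ≡ j₂) ⊎ (j₁ ≡ j₃) ⊎ (j₂ ≡ j₃)
at-most-two-types ℓ {u} has1 |u|>3^ℓ j₁ j₂ j₃ o₁ o₂ o₃ with one-offset u has1
... | w0 , w0<|u| , one-at =
  map-⊎ (same o₁ o₂) (map-⊎ (same o₁ o₃) (same o₂ o₃))
    (two-of-three (even o₁) (even o₂) (even o₃))
  where
  one : ∀ {j} (o : InType (suc ℓ) u j) → c (start (suc ℓ) o + w0) ≡ true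
  one (_ , _ , occ) = one-at _ occ
  even : ∀ {j} (o : InType (suc ℓ) u j) →
    digit ℓ (start (suc ℓ) o + w0) ≡ 0 ⊎ digit ℓ (start (suc ℓ) o + w0) ≡ 2
  even o = digit-of-one ℓ (start (suc ℓ) o + w0) (one o)
  same : ∀ {j j'} (o : InType (suc ℓ) u j) (o' : InType (suc ℓ) u j') →
    digit ℓ (start (suc ℓ) o + w0) ≡ digit ℓ (start (suc ℓ) o' + w0) → j ≡ j'
  same o o' = same-digit⇒same-type ℓ |u|>3^ℓ w0<|u| o o' (one o)

lemma4p4 : (ℓ : ℕ) → 1 ≤ ℓ → (u : List Bool) → IsFactor u → Contains1 u →
    3 ^ ℓ < length u → length u ≤ 3 ^ suc ℓ →
    (∃ λ j → InType (suc ℓ) u j) ×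
    ((j₁ j₂ j₃ : ℕ) → InType (suc ℓ) u j₁ → InType (suc ℓ) u j₂ → InType (suc ℓ) u j₃ →
      (j₁ ≡ j₂) ⊎ (j₁ ≡ j₃) ⊎ (j₂ ≡ j₃))
lemma4p4 ℓ _ u factor has1 |u|>3^ℓ _ = has-type (suc ℓ) factor , at-most-two-types ℓ has1 |u|>3^ℓ
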